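{- For every integer $m\ge0$, $$\sum_{\substack{k,n\ge 0\\ k+n=2m}} a_{k,n}=F_{2m+2},$$ where $(F_i)$ is the Fibonacci sequence with $F_1=F_2=1$ and $F_{i+1}=F_i+F_{i-1}$.
   Context: For nonnegative integers $p,q$, $a_{p,q}$ is the number of ways to partition a set consisting of $p$ marked points on a line and $q$ marked points on a parallel line into pairs, joining the two points of each pair by a straight segment, such that no two segments have a common point (in particular, no endpoint lies on another segment). We have $a_{0,0}=1$. -}

module Defs where

open import Data.Nat using (ℕ; zero; suc; _+_; _*_; _∸_; _<ᵇ_; _≡ᵇ_; _⊔_; _⊓_)
open import Data.Bool using (Bool; true; false; _∧_; _∨_; not; if_then_else_)
open import Data.Fin using (Fin; toℕ)
open import Data.Vec using (Vec; []; _∷_; lookup)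
open import Data.List using (List; []; _∷_; map; concatMap; filterᵇ; length; upTo; allFin)
open import Data.Nat.ListAction using (sum)

-- Marked points are indexed 0 .. p+q-1.  Index i < p is the point at position i
-- on the first line (positions increasing along the line); index p+j is the
-- point at position j on the second (parallel, equally oriented) line.

_≤ᵇ_ : ℕ → ℕ → Bool
a ≤ᵇ b = a <ᵇ suc b

module Geometry (p : ℕ) where

  onFirst : ℕ → Bool
  onFirst x = x <ᵇ p

  _==_ : Bool → Bool → Bool
  true  == b = b
  false == b = not b

  sameLine : ℕ → ℕ → Bool
  sameLine x y = onFirst x == onFirst y

  -- does the closed straight segment [x,y] (x,y on one line) contain the
  -- marked point w (w on that same line)?
  containsPt : ℕ → ℕ → ℕ → Bool
  containsPt x y w = ((x ⊓ y) ≤ᵇ w) ∧ (w ≤ᵇ (x ⊔ y))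

  firstEnd : ℕ → ℕ → ℕ
  firstEnd u v = if onFirst u then u else v

  secondEnd : ℕ → ℕ → ℕ
  secondEnd u v = if onFirst u then v else u

  endOnLineOf : ℕ → ℕ → ℕ → ℕ
  endOnLineOf x u v = if onFirst u == onFirst x then u else v

  meet : ℕ → ℕ → ℕ → ℕ → Bool
  meet x y u v with sameLine x y | sameLine u v
  ... | true  | true  =
    -- two collinear segments on a common line meet iff their intervals overlap;
    -- segments on different (parallel) lines never meet
    (onFirst x == onFirst u) ∧ (((x ⊓ y) ⊔ (u ⊓ v)) ≤ᵇ ((x ⊔ y) ⊓ (u ⊔ v)))
  ... | true  | false = containsPt x y (endOnLineOf x u v)
  ... | false | true  = containsPt u v (endOnLineOf u x y)
  ... | false | false =
    -- two segments joining the lines are disjoint iff they do not cross,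
    -- i.e. their endpoints are in the same strict order on both lines
    not ( ((firstEnd x y <ᵇ firstEnd u v) ∧ (secondEnd x y <ᵇ secondEnd u v))
        ∨ ((firstEnd u v <ᵇ firstEnd x y) ∧ (secondEnd u v <ᵇ secondEnd x y)))

-- A partition of the n = p+q points into pairs is encoded (bijectively) by the
-- fixed-point-free involution σ sending each point to its partner.
module Matchings (p q : ℕ) where
  open Geometry p

  n : ℕ
  n = p + q

  allB : {A : Set} → (A → Bool) → List A → Bool
  allB f []       = true
  allB f (x ∷ xs) = f x ∧ allB f xs

  isPairing : Vec (Fin n) n → Bool
  isPairing σ = allB (λ i →
      (toℕ (lookup σ (lookup σ i)) ≡ᵇ toℕ i) ∧ not (toℕ (lookup σ i) ≡ᵇ toℕ i))
    (allFin n)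

  nonCrossing : Vec (Fin n) n → Bool
  nonCrossing σ = allB (λ i → allB (λ j →
      let i' = toℕ i ; j' = toℕ j
          si = toℕ (lookup σ i) ; sj = toℕ (lookup σ j)
      in  (j' ≡ᵇ i') ∨ (j' ≡ᵇ si) ∨ not (meet i' si j' sj))
    (allFin n)) (allFin n)

  valid : Vec (Fin n) n → Bool
  valid σ = isPairing σ ∧ nonCrossing σ

allVecs : (n k : ℕ) → List (Vec (Fin n) k)
allVecs n zero    = [] ∷ []
allVecs n (suc k) = concatMap (λ i → map (i ∷_) (allVecs n k)) (allFin n)

a : ℕ → ℕ → ℕ
a p q = length (filterᵇ valid (allVecs n n))
  where open Matchings p q

F : ℕ → ℕ
F zero          = 0
F (suc zero)    = 1
F (suc (suc i)) = F (suc i) + F i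

diagSum : ℕ → ℕ
diagSum N = sum (map (λ k → a k (N ∸ k)) (upTo (suc N)))

{-# OPTIONS --safe #-}
module Submission where

-- Scan a pairing from left to right, remembering how many points s₁ and s₂ of the
-- two lines are already paired among themselves.  A segment inside a line contains
-- no other marked point, so it joins neighbours, and segments between the lines do
-- not cross; hence the first unpaired points are always paired in one of three
-- ways: the next two points of the first line (short₁), the next two of the second
-- (short₂), or the next point of each line (cross).  Recording these choices, and
-- taking short₁ before short₂ whenever both are possible, matches the admissible
-- pairings for p + q = 2m with the words of length m using p points of the first
-- line in which short₂ is never directly followed by short₁; formally, both sides
-- count the pairs (pairing, word) in which the word describes the pairing.  Summed
-- over p + q = 2m every such word is counted once, and the numbers f k of these
-- words and g k of those not starting with short₁ satisfy f (k+1) = 2 f k + g k and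
-- g (k+1) = f k + g k, whence f m = F (2m + 2).

open import Defs
open import Algebra.Properties.CommutativeSemigroup using (interchange)
open import Data.Bool using (Bool; true; false; T; _∧_; _∨_; not; if_then_else_)
open import Data.Bool.Properties using (T-∧; T-∨; T-≡)
open import Data.Empty using (⊥; ⊥-elim)
open import Data.Fin using (Fin; toℕ; fromℕ<) renaming (zero to fzero; suc to fsuc)
open import Data.Fin.Properties using (toℕ<n; toℕ-fromℕ<)
open import Data.List using (List; []; _∷_; [_]; _++_; map; concatMap; filterᵇ; length; allFin; upTo)
open import Data.List.Properties using (map-++; map-∘; map-cong; map-cong-local; length-++; length-map; map-tabulate; map-applyUpTo)
open import Data.List.Relation.Unary.All as All using (All; []; _∷_)
open import Data.List.Relation.Unary.All.Properties using (++⁺; map⁺; tabulate⁺; tabulate⁻; all-upTo)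
open import Data.Nat using (ℕ; zero; suc; _+_; _*_; _∸_; _≤_; _<_; _≡ᵇ_; _<ᵇ_; _⊔_; _⊓_; z≤n; s≤s; _≟_; _<?_)
open import Data.Nat.ListAction using (sum)
open import Data.Nat.ListAction.Properties using (sum-++)
open import Data.Nat.Properties
open import Data.Product using (_×_; _,_; proj₁; proj₂)
open import Data.Sum using (_⊎_; inj₁; inj₂; [_,_]′; fromInj₂; swap)
open import Data.Vec using (Vec; []; _∷_; lookup)
open import Function using (_∘_; _⇔_; Equivalence; mk⇔)
open import Relation.Binary.Definitions using (tri<; tri≈; tri>)
open import Relation.Binary.PropositionalEquality using (_≡_; _≢_; refl; sym; trans; cong; cong₂; subst; subst₂; module ≡-Reasoning)
open import Relation.Nullary using (¬_; Dec; yes; no)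
open import Relation.Nullary.Decidable using (T?)

<ᵇ⇒<′ : ∀ {m n} → T (m <ᵇ n) → m < n
<ᵇ⇒<′ = <ᵇ⇒< _ _

T-∧⁻ : ∀ {x y} → T (x ∧ y) → T x × T y
T-∧⁻ = Equivalence.to T-∧

T-∧⁺ : ∀ {x y} → T x → T y → T (x ∧ y)
T-∧⁺ tx ty = Equivalence.from T-∧ (tx , ty)

if-true : ∀ {A : Set} {b} {x y : A} → T b → (if b then x else y) ≡ x
if-true {b = true} _ = refl

if-false : ∀ {A : Set} {b} {x y : A} → ¬ T b → (if b then x else y) ≡ y
if-false {b = false} _  = refl
if-false {b = true}  ¬t = ⊥-elim (¬t _)

-- Defs._≤ᵇ_ is m <ᵇ suc n, not the library's _≤ᵇ_.
≤ᵇ⇒≤′ : ∀ {m n} → T (m ≤ᵇ n) → m ≤ n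
≤ᵇ⇒≤′ t = ≤-pred (<ᵇ⇒< _ _ t)

≤⇒≤ᵇ′ : ∀ {m n} → m ≤ n → T (m ≤ᵇ n)
≤⇒≤ᵇ′ m≤n = <⇒<ᵇ (s≤s m≤n)

¬T⇒≡false : ∀ {b} → ¬ T b → b ≡ false
¬T⇒≡false {false} _  = refl
¬T⇒≡false {true}  ¬t = ⊥-elim (¬t _)

T-not⁻ : ∀ {b} → T (not b) → ¬ T b
T-not⁻ {false} _ ()

T-not⁺ : ∀ {b} → ¬ T b → T (not b)
T-not⁺ {false} _  = _
T-not⁺ {true}  ¬t = ¬t _

if-either : ∀ {A : Set} b (x y : A) → (if b then x else y) ≡ x ⊎ (if b then x else y) ≡ y
if-either true  x y = inj₁ refl
if-either false x y = inj₂ refl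

χ : Bool → ℕ
χ true  = 1
χ false = 0

χ-true : ∀ {b} → T b → χ b ≡ 1
χ-true {true} _ = refl

χ-false : ∀ {b} → ¬ T b → χ b ≡ 0
χ-false {false} _ = refl
χ-false {true}  ¬t = ⊥-elim (¬t _)

∑ : {A : Set} → List A → (A → ℕ) → ℕ
∑ xs f = sum (map f xs)

syntax ∑ xs (λ x → e) = ∑[ x ← xs ] e

module _ {A : Set} where

  length-filterᵇ : (P : A → Bool) (xs : List A) → length (filterᵇ P xs) ≡ ∑[ x ← xs ] χ (P x)
  length-filterᵇ P []       = refl
  length-filterᵇ P (x ∷ xs) with P x
  ... | true  = cong suc (length-filterᵇ P xs)
  ... | false = length-filterᵇ P xs

  ∑-++ : (xs ys : List A) (f : A → ℕ) → ∑ (xs ++ ys) f ≡ ∑ xs f + ∑ ys f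
  ∑-++ xs ys f = trans (cong sum (map-++ f xs ys)) (sum-++ (map f xs) (map f ys))

  ∑-map : {B : Set} (h : B → A) (xs : List B) (f : A → ℕ) → ∑ (map h xs) f ≡ ∑ xs (f ∘ h)
  ∑-map h xs f = cong sum (sym (map-∘ xs))

  ∑-concatMap : {B : Set} (h : B → List A) (xs : List B) (f : A → ℕ) →
                ∑ (concatMap h xs) f ≡ ∑[ x ← xs ] ∑ (h x) f
  ∑-concatMap h []       f = refl
  ∑-concatMap h (x ∷ xs) f = trans (∑-++ (h x) (concatMap h xs) f) (cong (∑ (h x) f +_) (∑-concatMap h xs f))

  ∑-cong : {f g : A → ℕ} (xs : List A) → (∀ x → f x ≡ g x) → ∑ xs f ≡ ∑ xs g
  ∑-cong xs f≗g = cong sum (map-cong f≗g xs)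

  ∑-cong-local : {f g : A → ℕ} {xs : List A} → All (λ x → f x ≡ g x) xs → ∑ xs f ≡ ∑ xs g
  ∑-cong-local = cong sum ∘ map-cong-local

  ∑-zero : {f : A → ℕ} (xs : List A) → (∀ x → f x ≡ 0) → ∑ xs f ≡ 0
  ∑-zero []       f≡0 = refl
  ∑-zero (x ∷ xs) f≡0 = cong₂ _+_ (f≡0 x) (∑-zero xs f≡0)

  ∑-ones : {f : A → ℕ} {xs : List A} → All (λ x → f x ≡ 1) xs → ∑ xs f ≡ length xs
  ∑-ones []         = refl
  ∑-ones (fx≡1 ∷ p) = cong₂ _+_ fx≡1 (∑-ones p)

  ∑-+ : (xs : List A) (f g : A → ℕ) → ∑[ x ← xs ] (f x + g x) ≡ ∑ xs f + ∑ xs g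
  ∑-+ []       f g = refl
  ∑-+ (x ∷ xs) f g = trans (cong (f x + g x +_) (∑-+ xs f g)) (interchange +-commutativeSemigroup (f x) (g x) _ _)

  ∑-χ-∧ : (b : Bool) (P : A → Bool) (xs : List A) → ∑[ x ← xs ] χ (b ∧ P x) ≡ χ b * ∑[ x ← xs ] χ (P x)
  ∑-χ-∧ true  P xs = sym (+-identityʳ _)
  ∑-χ-∧ false P xs = ∑-zero xs (λ _ → refl)

∑-swap : {A B : Set} (xs : List A) (ys : List B) (f : A → B → ℕ) →
         ∑[ x ← xs ] ∑[ y ← ys ] f x y ≡ ∑[ y ← ys ] ∑[ x ← xs ] f x y
∑-swap []       ys f = sym (∑-zero ys (λ _ → refl))
∑-swap (x ∷ xs) ys f = trans (cong (∑ ys (f x) +_) (∑-swap xs ys f)) (sym (∑-+ ys (f x) _))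

∑-allFin-suc : ∀ N (f : Fin (suc N) → ℕ) → ∑ (allFin (suc N)) f ≡ f fzero + ∑[ x ← allFin N ] f (fsuc x)
∑-allFin-suc N f = cong (f fzero +_) (trans (cong (λ xs → ∑ xs f) (sym (map-tabulate (λ x → x) fsuc))) (∑-map fsuc (allFin N) f))

count-toℕ : ∀ N c → c < N → ∑[ x ← allFin N ] χ (toℕ x ≡ᵇ c) ≡ 1
count-toℕ (suc N) zero    _         = trans (∑-allFin-suc N (λ x → χ (toℕ x ≡ᵇ 0))) (cong suc (∑-zero (allFin N) (λ _ → refl)))
count-toℕ (suc N) (suc c) (s≤s c<N) = trans (∑-allFin-suc N (λ x → χ (toℕ x ≡ᵇ suc c))) (count-toℕ N c c<N)

∑-upTo-suc : ∀ N (f : ℕ → ℕ) → ∑ (upTo (suc N)) f ≡ f 0 + ∑[ k ← upTo N ] f (suc k)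
∑-upTo-suc N f = cong (f 0 +_) (trans (cong (λ ks → ∑ ks f) (sym (map-applyUpTo (λ k → k) suc N))) (∑-map suc (upTo N) f))

count-upTo : ∀ N c → c < N → ∑[ k ← upTo N ] χ (c ≡ᵇ k) ≡ 1
count-upTo (suc N) zero    _         = trans (∑-upTo-suc N (λ k → χ (0 ≡ᵇ k))) (cong suc (∑-zero (upTo N) (λ _ → refl)))
count-upTo (suc N) (suc c) (s≤s c<N) = trans (∑-upTo-suc N (λ k → χ (suc c ≡ᵇ k))) (count-upTo N c c<N)

-- Words

data Piece : Set where
  short₁ short₂ cross : Piece

Word : Set
Word = List Piece

-- The flag says that the previous piece was short₂; short₁ may not follow it, because
-- short₁ and short₂ commute and the scan takes short₁ first.
mutual
  canonical : Bool → ℕ → List Word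
  canonical b zero    = [ [] ]
  canonical b (suc k) = leadingShort₁ b k ++ map (short₂ ∷_) (canonical true k) ++ map (cross ∷_) (canonical false k)

  leadingShort₁ : Bool → ℕ → List Word
  leadingShort₁ false k = map (short₁ ∷_) (canonical false k)
  leadingShort₁ true  k = []

length-canonical : ∀ k → length (canonical false k) ≡ F (2 + 2 * k) × length (canonical true k) ≡ F (1 + 2 * k)
length-canonical zero    = refl , refl
length-canonical (suc k) = ℓfalse , ℓtrue
  where
  open ≡-Reasoning
  ℓtrue : length (canonical true (suc k)) ≡ F (1 + 2 * suc k)
  ℓtrue = begin
    length (canonical true (suc k))
      ≡⟨ length-++ (map (short₂ ∷_) (canonical true k)) ⟩
    length (map (short₂ ∷_) (canonical true k)) + length (map (cross ∷_) (canonical false k))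
      ≡⟨ cong₂ _+_ (length-map _ (canonical true k)) (length-map _ (canonical false k)) ⟩
    length (canonical true k) + length (canonical false k)
      ≡⟨ cong₂ _+_ (proj₂ (length-canonical k)) (proj₁ (length-canonical k)) ⟩
    F (1 + 2 * k) + F (2 + 2 * k)
      ≡⟨ +-comm (F (1 + 2 * k)) _ ⟩
    F (3 + 2 * k)
      ≡⟨ cong (F ∘ suc) (*-suc 2 k) ⟨
    F (1 + 2 * suc k) ∎
  ℓfalse : length (canonical false (suc k)) ≡ F (2 + 2 * suc k)
  ℓfalse = begin
    length (canonical false (suc k))
      ≡⟨ length-++ (map (short₁ ∷_) (canonical false k)) ⟩
    length (map (short₁ ∷_) (canonical false k)) + length (canonical true (suc k))
      ≡⟨ cong₂ _+_ (trans (length-map _ (canonical false k)) (proj₁ (length-canonical k))) ℓtrue ⟩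
    F (2 + 2 * k) + F (1 + 2 * suc k)
      ≡⟨ cong (λ j → F (2 + 2 * k) + F (1 + j)) (*-suc 2 k) ⟩
    F (2 + 2 * k) + F (3 + 2 * k)
      ≡⟨ +-comm (F (2 + 2 * k)) _ ⟩
    F (4 + 2 * k)
      ≡⟨ cong (F ∘ suc ∘ suc) (*-suc 2 k) ⟨
    F (2 + 2 * suc k) ∎

count₁ count₂ : Word → ℕ
count₁ []           = 0
count₁ (short₁ ∷ w) = 2 + count₁ w
count₁ (short₂ ∷ w) = count₁ w
count₁ (cross  ∷ w) = 1 + count₁ w
count₂ []           = 0
count₂ (short₁ ∷ w) = count₂ w
count₂ (short₂ ∷ w) = 2 + count₂ w
count₂ (cross  ∷ w) = 1 + count₂ w

count₁+count₂ : ∀ w → count₁ w + count₂ w ≡ 2 * length w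
count₁+count₂ []      = refl
count₁+count₂ (x ∷ w) = trans (one-piece x) (trans (cong (2 +_) (count₁+count₂ w)) (sym (*-suc 2 (length w))))
  where
  one-piece : ∀ x → count₁ (x ∷ w) + count₂ (x ∷ w) ≡ 2 + (count₁ w + count₂ w)
  one-piece short₁ = refl
  one-piece short₂ = trans (+-suc _ _) (cong suc (+-suc _ _))
  one-piece cross  = cong suc (+-suc _ _)

canonical-length : ∀ b k → All (λ w → length w ≡ k) (canonical b k)
canonical-length b zero    = refl ∷ []
canonical-length b (suc k) = ++⁺ (leading b) (++⁺ (consed true) (consed false))
  where
  consed : ∀ c {x} → All (λ w → length w ≡ suc k) (map (x ∷_) (canonical c k))
  consed c = map⁺ (All.map (cong suc) (canonical-length c k))
  leading : ∀ b → All (λ w → length w ≡ suc k) (leadingShort₁ b k)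
  leading false = consed false
  leading true  = []

uses : ℕ → ℕ → Word → Bool
uses p q w = (count₁ w ≡ᵇ p) ∧ (count₂ w ≡ᵇ q)

at : ∀ {N k} → Vec (Fin N) k → ℕ → ℕ
at []      i       = 0
at (x ∷ σ) zero    = toℕ x
at (x ∷ σ) (suc i) = at σ i

at-lookup : ∀ {N k} (σ : Vec (Fin N) k) (i : Fin k) → at σ (toℕ i) ≡ toℕ (lookup σ i)
at-lookup (x ∷ σ) fzero    = refl
at-lookup (x ∷ σ) (fsuc i) = at-lookup σ i

∀Fin⇔∀< : ∀ {n} {P : ℕ → Set} → (∀ (i : Fin n) → P (toℕ i)) ⇔ (∀ {i} → i < n → P i)
∀Fin⇔∀< {P = P} = mk⇔ (λ h {i} i<n → subst P (toℕ-fromℕ< i<n) (h (fromℕ< i<n))) (λ h i → h (toℕ<n i))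

at-< : ∀ {N k} (σ : Vec (Fin N) k) {i} → i < k → at σ i < N
at-< (x ∷ σ) {zero}  _         = toℕ<n x
at-< (x ∷ σ) {suc i} (s≤s i<k) = at-< σ i<k

count-agreeing : ∀ N k (P : Vec (Fin N) k → Bool) (h : ℕ → ℕ) → (∀ {i} → i < k → h i < N) →
                 (∀ σ → T (P σ) ⇔ (∀ {i} → i < k → at σ i ≡ h i)) →
                 ∑[ σ ← allVecs N k ] χ (P σ) ≡ 1
count-agreeing N zero    P h h<N P⇔ = cong (_+ 0) (χ-true (Equivalence.from (P⇔ []) (λ ())))
count-agreeing N (suc k) P h h<N P⇔ = begin
  ∑[ σ ← allVecs N (suc k) ] χ (P σ)
    ≡⟨ ∑-concatMap (λ x → map (x ∷_) (allVecs N k)) (allFin N) (χ ∘ P) ⟩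
  ∑[ x ← allFin N ] ∑[ σ ← map (x ∷_) (allVecs N k) ] χ (P σ)
    ≡⟨ ∑-cong (allFin N) (λ x → trans (∑-map (x ∷_) (allVecs N k) (χ ∘ P)) (with-head x)) ⟩
  ∑[ x ← allFin N ] χ (toℕ x ≡ᵇ h 0)
    ≡⟨ count-toℕ N (h 0) (h<N (s≤s z≤n)) ⟩
  1 ∎
  where
  open ≡-Reasoning
  with-head : ∀ x → ∑[ σ ← allVecs N k ] χ (P (x ∷ σ)) ≡ χ (toℕ x ≡ᵇ h 0)
  with-head x with toℕ x ≟ h 0
  ... | no  x≢h0 = trans (∑-zero (allVecs N k) (λ σ → χ-false (x≢h0 ∘ head-agrees σ))) (sym (χ-false (x≢h0 ∘ ≡ᵇ⇒≡ _ _)))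
    where head-agrees : ∀ σ → T (P (x ∷ σ)) → toℕ x ≡ h 0
          head-agrees σ t = Equivalence.to (P⇔ (x ∷ σ)) t (s≤s z≤n)
  ... | yes x≡h0 = trans (count-agreeing N k (P ∘ (x ∷_)) (h ∘ suc) (h<N ∘ s≤s) tail⇔) (sym (χ-true (≡⇒≡ᵇ _ _ x≡h0)))
    where tail⇔ : ∀ σ → T (P (x ∷ σ)) ⇔ (∀ {i} → i < k → at σ i ≡ h (suc i))
          tail⇔ σ = mk⇔ (λ t {i} i<k → Equivalence.to (P⇔ (x ∷ σ)) t {suc i} (s≤s i<k))
                        (λ agrees → Equivalence.from (P⇔ (x ∷ σ)) λ { {zero} _ → x≡h0 ; {suc i} (s≤s i<k) → agrees i<k })

-- Scanning a pairing

Adjacent : ℕ → ℕ → Set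
Adjacent i j = j ≡ suc i ⊎ i ≡ suc j

Adjacent-sym : ∀ {i j} → Adjacent i j → Adjacent j i
Adjacent-sym (inj₁ e) = inj₂ e
Adjacent-sym (inj₂ e) = inj₁ e

Adjacent-interval : ∀ {x y w} → Adjacent x y → x ⊓ y ≤ w → w ≤ x ⊔ y → w ≡ x ⊎ w ≡ y
Adjacent-interval {x} (inj₁ refl) lo hi =
  squeeze (subst (_≤ _) (m≤n⇒m⊓n≡m (n≤1+n x)) lo) (subst (_ ≤_) (m≤n⇒m⊔n≡n (n≤1+n x)) hi)
  where
  squeeze : ∀ {w} → x ≤ w → w ≤ suc x → w ≡ x ⊎ w ≡ suc x
  squeeze x≤w w≤1+x with m≤n⇒m<n∨m≡n x≤w
  ... | inj₁ x<w = inj₂ (≤-antisym w≤1+x x<w)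
  ... | inj₂ x≡w = inj₁ (sym x≡w)
Adjacent-interval {y = y} (inj₂ refl) lo hi =
  swap (Adjacent-interval (inj₁ refl) (subst (_≤ _) (⊓-comm (suc y) y) lo) (subst (_ ≤_) (⊔-comm (suc y) y) hi))

no-gap : ∀ {x y} → x < y → (∀ {j} → x < j → j < y → ⊥) → y ≡ suc x
no-gap {x} x<y gap with m≤n⇒m<n∨m≡n x<y
... | inj₁ 1+x<y = ⊥-elim (gap (n<1+n x) 1+x<y)
... | inj₂ 1+x≡y = sym 1+x≡y

module Scanning (p q : ℕ) where

  private variable
    s₁ s₂ i : ℕ

  -- In state (s₁, s₂) the points before s₁ on the first line and before p + s₂ on the
  -- second line are already paired among themselves.
  Unscanned : ℕ → ℕ → ℕ → Set
  Unscanned s₁ s₂ i = (s₁ ≤ i × i < p) ⊎ (p + s₂ ≤ i × i < p + q)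

  unscanned-split₁ : Unscanned s₁ s₂ i → i ≡ s₁ ⊎ Unscanned (suc s₁) s₂ i
  unscanned-split₁ (inj₁ (s₁≤i , i<p)) with m≤n⇒m<n∨m≡n s₁≤i
  ... | inj₁ s₁<i = inj₂ (inj₁ (s₁<i , i<p))
  ... | inj₂ s₁≡i = inj₁ (sym s₁≡i)
  unscanned-split₁ (inj₂ u) = inj₂ (inj₂ u)

  unscanned-split₂ : Unscanned s₁ s₂ i → i ≡ p + s₂ ⊎ Unscanned s₁ (suc s₂) i
  unscanned-split₂ (inj₁ u) = inj₂ (inj₁ u)
  unscanned-split₂ {s₂ = s₂} {i} (inj₂ (p+s₂≤i , i<p+q)) with m≤n⇒m<n∨m≡n p+s₂≤i
  ... | inj₁ p+s₂<i = inj₂ (inj₂ (subst (_≤ i) (sym (+-suc p s₂)) p+s₂<i , i<p+q))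
  ... | inj₂ p+s₂≡i = inj₁ (sym p+s₂≡i)

  unscanned-shrink₁ : Unscanned (suc s₁) s₂ i → Unscanned s₁ s₂ i
  unscanned-shrink₁ (inj₁ (s₁<i , i<p)) = inj₁ (<⇒≤ s₁<i , i<p)
  unscanned-shrink₁ (inj₂ u)            = inj₂ u

  unscanned-shrink₂ : Unscanned s₁ (suc s₂) i → Unscanned s₁ s₂ i
  unscanned-shrink₂ (inj₁ u) = inj₁ u
  unscanned-shrink₂ {s₂ = s₂} (inj₂ (p+s₂<i , i<p+q)) = inj₂ (≤-trans (+-monoʳ-≤ p (n≤1+n s₂)) p+s₂<i , i<p+q)

  unscanned-first₁ : s₁ < p → Unscanned s₁ s₂ s₁
  unscanned-first₁ s₁<p = inj₁ (≤-refl , s₁<p)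

  unscanned-first₂ : s₂ < q → Unscanned s₁ s₂ (p + s₂)
  unscanned-first₂ s₂<q = inj₂ (≤-refl , +-monoʳ-< p s₂<q)

  unscanned-line₁ : Unscanned s₁ s₂ i → i < p → s₁ ≤ i
  unscanned-line₁ (inj₁ (s₁≤i , _)) _ = s₁≤i
  unscanned-line₁ {s₂ = s₂} (inj₂ (p+s₂≤i , _)) i<p = ⊥-elim (<⇒≱ i<p (m+n≤o⇒m≤o p p+s₂≤i))

  unscanned-line₂ : Unscanned s₁ s₂ i → p ≤ i → p + s₂ ≤ i
  unscanned-line₂ (inj₁ (_ , i<p)) p≤i = ⊥-elim (<⇒≱ i<p p≤i)
  unscanned-line₂ (inj₂ (p+s₂≤i , _)) _ = p+s₂≤i

  unscanned-< : Unscanned s₁ s₂ i → i < p + q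
  unscanned-< (inj₁ (_ , i<p)) = <-≤-trans i<p (m≤m+n p q)
  unscanned-< (inj₂ (_ , i<p+q)) = i<p+q

  unscanned-initial : i < p + q → Unscanned 0 0 i
  unscanned-initial {i} i<p+q with i <? p
  ... | yes i<p = inj₁ (z≤n , i<p)
  ... | no  i≮p = inj₂ (subst (_≤ i) (sym (+-identityʳ p)) (≮⇒≥ i≮p) , i<p+q)

  T-done : T ((s₁ ≡ᵇ p) ∧ (s₂ ≡ᵇ q)) ⇔ (s₁ ≡ p × s₂ ≡ q)
  T-done = mk⇔ (λ t → ≡ᵇ⇒≡ _ _ (proj₁ (T-∧⁻ t)) , ≡ᵇ⇒≡ _ _ (proj₂ (T-∧⁻ t)))
               (λ (s₁≡p , s₂≡q) → T-∧⁺ (≡⇒≡ᵇ _ _ s₁≡p) (≡⇒≡ᵇ _ _ s₂≡q))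

  unscanned-final : s₁ ≡ p × s₂ ≡ q → ¬ Unscanned s₁ s₂ i
  unscanned-final (refl , refl) (inj₁ (p≤i , i<p))     = <⇒≱ i<p p≤i
  unscanned-final (refl , refl) (inj₂ (p+q≤i , i<p+q)) = <⇒≱ i<p+q p+q≤i

  scanned₁ : s₁ < p → Unscanned (suc s₁) s₂ i → i ≢ s₁
  scanned₁ _ (inj₁ (s₁<i , _)) refl = n≮n _ s₁<i
  scanned₁ {s₂ = s₂} s₁<p (inj₂ (p+s₂≤i , _)) refl = <⇒≱ s₁<p (m+n≤o⇒m≤o p p+s₂≤i)

  scanned₂ : Unscanned s₁ (suc s₂) i → i ≢ p + s₂
  scanned₂ {s₂ = s₂} (inj₁ (_ , i<p)) refl = <⇒≱ i<p (m≤m+n p s₂)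
  scanned₂ {s₂ = s₂} (inj₂ (p+s₂<i , _)) refl = n≮n _ (subst (_≤ p + s₂) (+-suc p s₂) p+s₂<i)

  step₁ step₂ : Piece → ℕ → ℕ
  step₁ short₁ s = 2 + s
  step₁ short₂ s = s
  step₁ cross  s = 1 + s
  step₂ short₁ s = s
  step₂ short₂ s = 2 + s
  step₂ cross  s = 1 + s

  left right : Piece → ℕ → ℕ → ℕ
  left  short₁ s₁ s₂ = s₁
  left  short₂ s₁ s₂ = p + s₂
  left  cross  s₁ s₂ = s₁
  right short₁ s₁ s₂ = suc s₁
  right short₂ s₁ s₂ = suc (p + s₂)
  right cross  s₁ s₂ = p + s₂

  fitsAt : Piece → ℕ → ℕ → Bool
  fitsAt short₁ s₁ s₂ = suc s₁ <ᵇ p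
  fitsAt short₂ s₁ s₂ = suc s₂ <ᵇ q
  fitsAt cross  s₁ s₂ = (s₁ <ᵇ p) ∧ (s₂ <ᵇ q)

  IsEnd : Piece → ℕ → ℕ → ℕ → Set
  IsEnd x s₁ s₂ i = i ≡ left x s₁ s₂ ⊎ i ≡ right x s₁ s₂

  cross-fits : T (fitsAt cross s₁ s₂) → s₁ < p × s₂ < q
  cross-fits t = <ᵇ⇒<′ (proj₁ (T-∧⁻ t)) , <ᵇ⇒<′ (proj₂ (T-∧⁻ t))

  piece-split : ∀ x → Unscanned s₁ s₂ i → IsEnd x s₁ s₂ i ⊎ Unscanned (step₁ x s₁) (step₂ x s₂) i
  piece-split short₁ u with unscanned-split₁ u
  ... | inj₁ i≡ℓ = inj₁ (inj₁ i≡ℓ)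
  ... | inj₂ u′ with unscanned-split₁ u′
  ...   | inj₁ i≡r = inj₁ (inj₂ i≡r)
  ...   | inj₂ u″  = inj₂ u″
  piece-split {s₂ = s₂} short₂ u with unscanned-split₂ u
  ... | inj₁ i≡ℓ = inj₁ (inj₁ i≡ℓ)
  ... | inj₂ u′ with unscanned-split₂ u′
  ...   | inj₁ i≡r = inj₁ (inj₂ (trans i≡r (+-suc p s₂)))
  ...   | inj₂ u″  = inj₂ u″
  piece-split cross u with unscanned-split₁ u
  ... | inj₁ i≡ℓ = inj₁ (inj₁ i≡ℓ)
  ... | inj₂ u′ with unscanned-split₂ u′
  ...   | inj₁ i≡r = inj₁ (inj₂ i≡r)
  ...   | inj₂ u″  = inj₂ u″

  piece-shrink : ∀ x → Unscanned (step₁ x s₁) (step₂ x s₂) i → Unscanned s₁ s₂ i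
  piece-shrink short₁ = unscanned-shrink₁ ∘ unscanned-shrink₁
  piece-shrink short₂ = unscanned-shrink₂ ∘ unscanned-shrink₂
  piece-shrink cross  = unscanned-shrink₁ ∘ unscanned-shrink₂

  ends-unscanned : ∀ x → T (fitsAt x s₁ s₂) → IsEnd x s₁ s₂ i → Unscanned s₁ s₂ i
  ends-unscanned short₁ t (inj₁ refl) = unscanned-first₁ (<-trans (n<1+n _) (<ᵇ⇒<′ t))
  ends-unscanned short₁ t (inj₂ refl) = unscanned-shrink₁ (unscanned-first₁ (<ᵇ⇒<′ t))
  ends-unscanned short₂ t (inj₁ refl) = unscanned-first₂ (<-trans (n<1+n _) (<ᵇ⇒<′ t))
  ends-unscanned {s₂ = s₂} short₂ t (inj₂ refl) =
    subst (Unscanned _ _) (+-suc p s₂) (unscanned-shrink₂ (unscanned-first₂ (<ᵇ⇒<′ t)))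
  ends-unscanned cross t (inj₁ refl) = unscanned-first₁ (proj₁ (cross-fits t))
  ends-unscanned cross t (inj₂ refl) = unscanned-first₂ (proj₂ (cross-fits t))

  left≢right : ∀ x → T (fitsAt x s₁ s₂) → left x s₁ s₂ ≢ right x s₁ s₂
  left≢right short₁ _ = 1+n≢n ∘ sym
  left≢right short₂ _ = 1+n≢n ∘ sym
  left≢right {s₂ = s₂} cross t s₁≡p+s₂ = <⇒≱ (proj₁ (cross-fits t)) (subst (p ≤_) (sym s₁≡p+s₂) (m≤m+n p s₂))

  next-not-end : ∀ x → T (fitsAt x s₁ s₂) → Unscanned (step₁ x s₁) (step₂ x s₂) i → ¬ IsEnd x s₁ s₂ i
  next-not-end short₁ t u (inj₁ i≡ℓ) = scanned₁ (<-trans (n<1+n _) (<ᵇ⇒<′ t)) (unscanned-shrink₁ u) i≡ℓ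
  next-not-end short₁ t u (inj₂ i≡r) = scanned₁ (<ᵇ⇒<′ t) u i≡r
  next-not-end short₂ t u (inj₁ i≡ℓ) = scanned₂ (unscanned-shrink₂ u) i≡ℓ
  next-not-end {s₂ = s₂} short₂ t u (inj₂ i≡r) = scanned₂ u (trans i≡r (sym (+-suc p s₂)))
  next-not-end cross t u (inj₁ i≡ℓ) = scanned₁ (proj₁ (cross-fits t)) (unscanned-shrink₂ u) i≡ℓ
  next-not-end cross t u (inj₂ i≡r) = scanned₂ u i≡r

  joins : (ℕ → ℕ) → ℕ → ℕ → Bool
  joins g a b = (g a ≡ᵇ b) ∧ (g b ≡ᵇ a)

  placed : Piece → ℕ → ℕ → (ℕ → ℕ) → Bool
  placed x s₁ s₂ g = fitsAt x s₁ s₂ ∧ joins g (left x s₁ s₂) (right x s₁ s₂)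

  matches : ℕ → ℕ → Word → (ℕ → ℕ) → Bool
  matches s₁ s₂ []      g = (s₁ ≡ᵇ p) ∧ (s₂ ≡ᵇ q)
  matches s₁ s₂ (x ∷ w) g = placed x s₁ s₂ g ∧ matches (step₁ x s₁) (step₂ x s₂) w g

  decode : ℕ → ℕ → Word → ℕ → ℕ
  decode s₁ s₂ []      i = 0
  decode s₁ s₂ (x ∷ w) i =
    if i ≡ᵇ left x s₁ s₂ then right x s₁ s₂ else
    if i ≡ᵇ right x s₁ s₂ then left x s₁ s₂ else
    decode (step₁ x s₁) (step₂ x s₂) w i

  decode-left : ∀ x w → decode s₁ s₂ (x ∷ w) (left x s₁ s₂) ≡ right x s₁ s₂
  decode-left {s₁} {s₂} x w = if-true (≡⇒≡ᵇ (left x s₁ s₂) _ refl)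

  decode-right : ∀ x w → left x s₁ s₂ ≢ right x s₁ s₂ → decode s₁ s₂ (x ∷ w) (right x s₁ s₂) ≡ left x s₁ s₂
  decode-right {s₁} {s₂} x w ℓ≢r = trans (if-false (ℓ≢r ∘ sym ∘ ≡ᵇ⇒≡ _ _)) (if-true (≡⇒≡ᵇ (right x s₁ s₂) _ refl))

  decode-next : ∀ x w → ¬ IsEnd x s₁ s₂ i → decode s₁ s₂ (x ∷ w) i ≡ decode (step₁ x s₁) (step₂ x s₂) w i
  decode-next x w ¬end = trans (if-false (¬end ∘ inj₁ ∘ ≡ᵇ⇒≡ _ _)) (if-false (¬end ∘ inj₂ ∘ ≡ᵇ⇒≡ _ _))

  Completes : ℕ → ℕ → Word → Set
  Completes s₁ s₂ w = s₁ + count₁ w ≡ p × s₂ + count₂ w ≡ q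

  step₁-count : ∀ x s w → step₁ x s + count₁ w ≡ s + count₁ (x ∷ w)
  step₁-count short₁ s w = sym (trans (+-suc s _) (cong suc (+-suc s _)))
  step₁-count short₂ s w = refl
  step₁-count cross  s w = sym (+-suc s _)

  step₂-count : ∀ x s w → step₂ x s + count₂ w ≡ s + count₂ (x ∷ w)
  step₂-count short₁ s w = refl
  step₂-count short₂ s w = sym (trans (+-suc s _) (cong suc (+-suc s _)))
  step₂-count cross  s w = sym (+-suc s _)

  completes-cons : ∀ x w → Completes (step₁ x s₁) (step₂ x s₂) w → Completes s₁ s₂ (x ∷ w)
  completes-cons {s₁} {s₂} x w (e₁ , e₂) = trans (sym (step₁-count x s₁ w)) e₁ , trans (sym (step₂-count x s₂ w)) e₂

  fitsAt-intro : ∀ x → step₁ x s₁ ≤ p → step₂ x s₂ ≤ q → T (fitsAt x s₁ s₂)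
  fitsAt-intro short₁ b₁ b₂ = <⇒<ᵇ b₁
  fitsAt-intro short₂ b₁ b₂ = <⇒<ᵇ b₂
  fitsAt-intro cross  b₁ b₂ = T-∧⁺ (<⇒<ᵇ b₁) (<⇒<ᵇ b₂)

  completes-uncons : ∀ x w → Completes s₁ s₂ (x ∷ w) → T (fitsAt x s₁ s₂) × Completes (step₁ x s₁) (step₂ x s₂) w
  completes-uncons {s₁} {s₂} x w (e₁ , e₂) =
    fitsAt-intro x (subst (step₁ x s₁ ≤_) e₁′ (m≤m+n _ _)) (subst (step₂ x s₂ ≤_) e₂′ (m≤m+n _ _)) , e₁′ , e₂′
    where
    e₁′ = trans (step₁-count x s₁ w) e₁
    e₂′ = trans (step₂-count x s₂ w) e₂

  Agrees : ℕ → ℕ → (ℕ → ℕ) → (ℕ → ℕ) → Set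
  Agrees s₁ s₂ g h = ∀ {i} → Unscanned s₁ s₂ i → g i ≡ h i

  record Admissible (s₁ s₂ : ℕ) (g : ℕ → ℕ) : Set where
    field
      pairs     : ∀ {i} → Unscanned s₁ s₂ i → Unscanned s₁ s₂ (g i) × g (g i) ≡ i × g i ≢ i
      adjacent₁ : ∀ {i} → Unscanned s₁ s₂ i → i < p → g i < p → Adjacent i (g i)
      adjacent₂ : ∀ {i} → Unscanned s₁ s₂ i → p ≤ i → p ≤ g i → Adjacent i (g i)
      monotone  : ∀ {i j} → Unscanned s₁ s₂ i → Unscanned s₁ s₂ j → i < j → j < p → p ≤ g i → p ≤ g j → g i < g j

  open Admissible

  ends-adjacent₁ : ∀ x → left x s₁ s₂ < p → right x s₁ s₂ < p → Adjacent (left x s₁ s₂) (right x s₁ s₂)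
  ends-adjacent₁ short₁ _ _ = inj₁ refl
  ends-adjacent₁ {s₂ = s₂} short₂ ℓ<p _ = ⊥-elim (<⇒≱ ℓ<p (m≤m+n p s₂))
  ends-adjacent₁ {s₂ = s₂} cross _ r<p = ⊥-elim (<⇒≱ r<p (m≤m+n p s₂))

  ends-adjacent₂ : ∀ x → T (fitsAt x s₁ s₂) → p ≤ left x s₁ s₂ → Adjacent (left x s₁ s₂) (right x s₁ s₂)
  ends-adjacent₂ short₁ t p≤ℓ = ⊥-elim (<⇒≱ (<-trans (n<1+n _) (<ᵇ⇒<′ t)) p≤ℓ)
  ends-adjacent₂ short₂ _ _   = inj₁ refl
  ends-adjacent₂ cross  t p≤ℓ = ⊥-elim (<⇒≱ (proj₁ (cross-fits t)) p≤ℓ)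

  Remaining : ℕ → ℕ → ℕ → Set
  Remaining k s₁ s₂ = s₁ ≤ p × s₂ ≤ q × s₁ + s₂ + 2 * k ≡ p + q

  remaining-zero : Remaining 0 s₁ s₂ → s₁ ≡ p × s₂ ≡ q
  remaining-zero {s₁} {s₂} (s₁≤p , s₂≤q , e) = s₁≡p , +-cancelˡ-≡ p s₂ q (trans (cong (_+ s₂) (sym s₁≡p)) e′)
    where
    e′ : s₁ + s₂ ≡ p + q
    e′ = trans (sym (+-identityʳ _)) e
    s₁≡p : s₁ ≡ p
    s₁≡p = ≤-antisym s₁≤p (+-cancelʳ-≤ q p s₁ (subst (_≤ s₁ + q) e′ (+-monoʳ-≤ s₁ s₂≤q)))

  remaining-suc : ∀ {k} → Remaining (suc k) s₁ s₂ → s₁ < p ⊎ s₂ < q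
  remaining-suc {s₁} {s₂} {k} (_ , _ , e) with s₁ <? p | s₂ <? q
  ... | yes s₁<p | _        = inj₁ s₁<p
  ... | no  _    | yes s₂<q = inj₂ s₂<q
  ... | no  s₁≮p | no  s₂≮q = ⊥-elim (<⇒≱ (m<m+n (s₁ + s₂) (s≤s z≤n)) (begin
      s₁ + s₂ + 2 * suc k ≡⟨ e ⟩
      p + q               ≤⟨ +-mono-≤ (≮⇒≥ s₁≮p) (≮⇒≥ s₂≮q) ⟩
      s₁ + s₂             ∎))
    where open ≤-Reasoning

  step-total : ∀ x s₁ s₂ → step₁ x s₁ + step₂ x s₂ ≡ 2 + (s₁ + s₂)
  step-total short₁ s₁ s₂ = refl
  step-total short₂ s₁ s₂ = trans (+-suc s₁ _) (cong suc (+-suc s₁ s₂))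
  step-total cross  s₁ s₂ = cong suc (+-suc s₁ s₂)

  step-bounds : ∀ x → T (fitsAt x s₁ s₂) → s₁ ≤ p → s₂ ≤ q → step₁ x s₁ ≤ p × step₂ x s₂ ≤ q
  step-bounds short₁ t _ s₂≤q = <ᵇ⇒<′ t , s₂≤q
  step-bounds short₂ t s₁≤p _ = s₁≤p , <ᵇ⇒<′ t
  step-bounds cross  t _ _    = cross-fits t

  remaining-step : ∀ x {k} → T (fitsAt x s₁ s₂) → Remaining (suc k) s₁ s₂ → Remaining k (step₁ x s₁) (step₂ x s₂)
  remaining-step {s₁} {s₂} x {k} t (s₁≤p , s₂≤q , e) = proj₁ bounds , proj₂ bounds , (begin
    step₁ x s₁ + step₂ x s₂ + 2 * k ≡⟨ cong (_+ 2 * k) (step-total x s₁ s₂) ⟩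
    2 + (s₁ + s₂ + 2 * k)           ≡⟨ sym (trans (+-suc _ _) (cong suc (+-suc _ _))) ⟩
    s₁ + s₂ + (2 + 2 * k)           ≡⟨ cong (s₁ + s₂ +_) (sym (*-suc 2 k)) ⟩
    s₁ + s₂ + 2 * suc k             ≡⟨ e ⟩
    p + q                           ∎)
    where
    open ≡-Reasoning
    bounds = step-bounds x t s₁≤p s₂≤q

  module _ (g : ℕ → ℕ) where

    placed⁻ : ∀ x → T (placed x s₁ s₂ g) →
              T (fitsAt x s₁ s₂) × g (left x s₁ s₂) ≡ right x s₁ s₂ × g (right x s₁ s₂) ≡ left x s₁ s₂
    placed⁻ x t with T-∧⁻ t
    ... | fits , j with T-∧⁻ j
    ...   | gℓ , gr = fits , ≡ᵇ⇒≡ _ _ gℓ , ≡ᵇ⇒≡ _ _ gr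

    placed⁺ : ∀ x → T (fitsAt x s₁ s₂) → g (left x s₁ s₂) ≡ right x s₁ s₂ → g (right x s₁ s₂) ≡ left x s₁ s₂ →
              T (placed x s₁ s₂ g)
    placed⁺ x fits gℓ gr = T-∧⁺ fits (T-∧⁺ (≡⇒≡ᵇ _ _ gℓ) (≡⇒≡ᵇ _ _ gr))

    matches⇒ : ∀ w → T (matches s₁ s₂ w g) → Completes s₁ s₂ w × Agrees s₁ s₂ g (decode s₁ s₂ w)
    matches⇒ {s₁} {s₂} [] t = (trans (+-identityʳ s₁) (proj₁ done) , trans (+-identityʳ s₂) (proj₂ done))
                            , ⊥-elim ∘ unscanned-final done
      where done = Equivalence.to T-done t
    matches⇒ (x ∷ w) t with T-∧⁻ t
    ... | tx , tw with placed⁻ x tx | matches⇒ w tw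
    ...   | fits , gℓ , gr | fits′ , agrees′ = completes-cons x w fits′ , agrees
      where
      agrees : Agrees _ _ g (decode _ _ (x ∷ w))
      agrees u with piece-split x u
      ... | inj₁ (inj₁ refl) = trans gℓ (sym (decode-left x w))
      ... | inj₁ (inj₂ refl) = trans gr (sym (decode-right x w (left≢right x fits)))
      ... | inj₂ u′          = trans (agrees′ u′) (sym (decode-next x w (next-not-end x fits u′)))

    matches⇐ : ∀ w → Completes s₁ s₂ w → Agrees s₁ s₂ g (decode s₁ s₂ w) → T (matches s₁ s₂ w g)
    matches⇐ {s₁} {s₂} [] (e₁ , e₂) _ =
      Equivalence.from T-done (trans (sym (+-identityʳ s₁)) e₁ , trans (sym (+-identityʳ s₂)) e₂)
    matches⇐ (x ∷ w) f agrees with completes-uncons x w f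
    ... | fits , f′ = T-∧⁺ (placed⁺ x fits gℓ gr) (matches⇐ w f′ agrees′)
      where
      gℓ = trans (agrees (ends-unscanned x fits (inj₁ refl))) (decode-left x w)
      gr = trans (agrees (ends-unscanned x fits (inj₂ refl))) (decode-right x w (left≢right x fits))
      agrees′ : Agrees _ _ _ (decode _ _ w)
      agrees′ u = trans (agrees (piece-shrink x u)) (decode-next x w (next-not-end x fits u))

    crossing-end : ∀ x → T (placed x s₁ s₂ g) → IsEnd x s₁ s₂ i → i < p → p ≤ g i → x ≡ cross × i ≡ s₁
    crossing-end {s₂ = s₂} short₁ t (inj₁ refl) _ p≤gi with placed⁻ {s₂ = s₂} short₁ t
    ... | fits , gℓ , _ = ⊥-elim (<⇒≱ (<ᵇ⇒<′ fits) (subst (p ≤_) gℓ p≤gi))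
    crossing-end {s₂ = s₂} short₁ t (inj₂ refl) _ p≤gi with placed⁻ {s₂ = s₂} short₁ t
    ... | fits , _ , gr = ⊥-elim (<⇒≱ (<-trans (n<1+n _) (<ᵇ⇒<′ fits)) (subst (p ≤_) gr p≤gi))
    crossing-end {s₂ = s₂} short₂ _ (inj₁ refl) i<p _ = ⊥-elim (<⇒≱ i<p (m≤m+n p s₂))
    crossing-end {s₂ = s₂} short₂ _ (inj₂ refl) i<p _ = ⊥-elim (<⇒≱ i<p (≤-trans (m≤m+n p s₂) (n≤1+n _)))
    crossing-end cross _ (inj₁ refl) _ _ = refl , refl
    crossing-end {s₂ = s₂} cross _ (inj₂ refl) i<p _ = ⊥-elim (<⇒≱ i<p (m≤m+n p s₂))

    admissible-cons : ∀ x → T (placed x s₁ s₂ g) → Admissible (step₁ x s₁) (step₂ x s₂) g → Admissible s₁ s₂ g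
    admissible-cons {s₁} {s₂} x t A = record
      { pairs = pairs′ ; adjacent₁ = adjacent₁′ ; adjacent₂ = adjacent₂′ ; monotone = monotone′ }
      where
      fits = proj₁ (placed⁻ x t)
      gℓ   = proj₁ (proj₂ (placed⁻ x t))
      gr   = proj₂ (proj₂ (placed⁻ x t))
      ℓ≢r  = left≢right x fits

      pairs′ : ∀ {i} → Unscanned s₁ s₂ i → Unscanned s₁ s₂ (g i) × g (g i) ≡ i × g i ≢ i
      pairs′ u with piece-split x u
      ... | inj₁ (inj₁ refl) = subst (Unscanned s₁ s₂) (sym gℓ) (ends-unscanned x fits (inj₂ refl))
                             , trans (cong g gℓ) gr , λ gℓ≡ℓ → ℓ≢r (trans (sym gℓ≡ℓ) gℓ)
      ... | inj₁ (inj₂ refl) = subst (Unscanned s₁ s₂) (sym gr) (ends-unscanned x fits (inj₁ refl))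
                             , trans (cong g gr) gℓ , λ gr≡r → ℓ≢r (sym (trans (sym gr≡r) gr))
      ... | inj₂ u′ with pairs A u′
      ...   | gu′ , ggi , gi≢i = piece-shrink x gu′ , ggi , gi≢i

      adjacent₁′ : ∀ {i} → Unscanned s₁ s₂ i → i < p → g i < p → Adjacent i (g i)
      adjacent₁′ u i<p gi<p with piece-split x u
      ... | inj₁ (inj₁ refl) = subst (Adjacent _) (sym gℓ) (ends-adjacent₁ x i<p (subst (_< p) gℓ gi<p))
      ... | inj₁ (inj₂ refl) = subst (Adjacent _) (sym gr) (Adjacent-sym (ends-adjacent₁ x (subst (_< p) gr gi<p) i<p))
      ... | inj₂ u′          = adjacent₁ A u′ i<p gi<p

      adjacent₂′ : ∀ {i} → Unscanned s₁ s₂ i → p ≤ i → p ≤ g i → Adjacent i (g i)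
      adjacent₂′ u p≤i p≤gi with piece-split x u
      ... | inj₁ (inj₁ refl) = subst (Adjacent _) (sym gℓ) (ends-adjacent₂ x fits p≤i)
      ... | inj₁ (inj₂ refl) = subst (Adjacent _) (sym gr) (Adjacent-sym (ends-adjacent₂ x fits (subst (p ≤_) gr p≤gi)))
      ... | inj₂ u′          = adjacent₂ A u′ p≤i p≤gi

      monotone′ : ∀ {i j} → Unscanned s₁ s₂ i → Unscanned s₁ s₂ j → i < j → j < p → p ≤ g i → p ≤ g j → g i < g j
      monotone′ {i} {j} u v i<j j<p p≤gi p≤gj with piece-split x u | piece-split x v
      ... | inj₂ u′ | inj₂ v′ = monotone A u′ v′ i<j j<p p≤gi p≤gj
      ... | inj₂ u′ | inj₁ end with crossing-end x t end j<p p≤gj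
      ...   | refl , refl = ⊥-elim (<⇒≱ i<j (unscanned-line₁ u (<-trans i<j j<p)))
      monotone′ {i} {j} u v i<j j<p p≤gi p≤gj | inj₁ end | v-split with crossing-end x t end (<-trans i<j j<p) p≤gi
      monotone′ {i} {j} u v i<j j<p p≤gi p≤gj | inj₁ end | inj₁ end′ | refl , refl
        with crossing-end cross t end′ j<p p≤gj
      ... | _ , refl = ⊥-elim (n≮n _ i<j)
      monotone′ {i} {j} u v i<j j<p p≤gi p≤gj | inj₁ end | inj₂ v′ | refl , refl =
        subst (_< g j) (sym gℓ) (subst (_≤ g j) (+-suc p s₂) (unscanned-line₂ (proj₁ (pairs A v′)) p≤gj))

    admissible-of-matches : ∀ w → T (matches s₁ s₂ w g) → Admissible s₁ s₂ g
    admissible-of-matches [] t = record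
      { pairs = ⊥-elim ∘ final ; adjacent₁ = ⊥-elim ∘ final ; adjacent₂ = ⊥-elim ∘ final ; monotone = ⊥-elim ∘ final }
      where
      final : ∀ {i} → ¬ Unscanned _ _ i
      final = unscanned-final (Equivalence.to T-done t)
    admissible-of-matches (x ∷ w) t = admissible-cons x (proj₁ (T-∧⁻ t)) (admissible-of-matches w (proj₂ (T-∧⁻ t)))

    admissible-step : ∀ x → T (placed x s₁ s₂ g) → Admissible s₁ s₂ g → Admissible (step₁ x s₁) (step₂ x s₂) g
    admissible-step {s₁} {s₂} x t A = record
      { pairs     = λ u → closed u , proj₂ (pairs A (piece-shrink x u))
      ; adjacent₁ = adjacent₁ A ∘ piece-shrink x
      ; adjacent₂ = adjacent₂ A ∘ piece-shrink x
      ; monotone  = λ u v → monotone A (piece-shrink x u) (piece-shrink x v)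
      }
      where
      fits = proj₁ (placed⁻ x t)
      gℓ   = proj₁ (proj₂ (placed⁻ x t))
      gr   = proj₂ (proj₂ (placed⁻ x t))
      closed : ∀ {i} → Unscanned (step₁ x s₁) (step₂ x s₂) i → Unscanned (step₁ x s₁) (step₂ x s₂) (g i)
      closed {i} u with pairs A (piece-shrink x u)
      ... | gu , ggi , _ with piece-split x gu
      ...   | inj₁ (inj₁ gi≡ℓ) = ⊥-elim (next-not-end x fits u (inj₂ (trans (sym ggi) (trans (cong g gi≡ℓ) gℓ))))
      ...   | inj₁ (inj₂ gi≡r) = ⊥-elim (next-not-end x fits u (inj₁ (trans (sym ggi) (trans (cong g gi≡r) gr))))
      ...   | inj₂ gu′         = gu′

    countMatches : Bool → ℕ → ℕ → ℕ → ℕ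
    countMatches b k s₁ s₂ = ∑[ w ← canonical b k ] χ (matches s₁ s₂ w g)

    viaPiece : Piece → Bool → ℕ → ℕ → ℕ → ℕ
    viaPiece x b k s₁ s₂ = χ (placed x s₁ s₂ g) * countMatches b k (step₁ x s₁) (step₂ x s₂)

    viaShort₁ : Bool → ℕ → ℕ → ℕ → ℕ
    viaShort₁ false k s₁ s₂ = viaPiece short₁ false k s₁ s₂
    viaShort₁ true  _ _  _  = 0

    countMatches-suc : ∀ b k → countMatches b (suc k) s₁ s₂ ≡
                       viaShort₁ b k s₁ s₂ + (viaPiece short₂ true k s₁ s₂ + viaPiece cross false k s₁ s₂)
    countMatches-suc {s₁} {s₂} b k =
      trans (∑-++ (leadingShort₁ b k) _ f)
            (cong₂ _+_ (leading b) (trans (∑-++ (map (short₂ ∷_) (canonical true k)) _ f)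
                                          (cong₂ _+_ (via short₂ (canonical true k)) (via cross (canonical false k)))))
      where
      f : Word → ℕ
      f w = χ (matches s₁ s₂ w g)
      via : ∀ x ws → ∑ (map (x ∷_) ws) f ≡ χ (placed x s₁ s₂ g) * ∑[ w ← ws ] χ (matches (step₁ x s₁) (step₂ x s₂) w g)
      via x ws = trans (∑-map (x ∷_) ws f) (∑-χ-∧ (placed x s₁ s₂ g) _ ws)
      leading : ∀ b → ∑ (leadingShort₁ b k) f ≡ viaShort₁ b k s₁ s₂
      leading false = via short₁ (canonical false k)
      leading true  = refl

    short₁-excludes-cross : T (placed short₁ s₁ s₂ g) → ¬ T (placed cross s₁ s₂ g)
    short₁-excludes-cross {s₁} {s₂} t₁ t₃ with placed⁻ {s₂ = s₂} short₁ t₁ | placed⁻ cross t₃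
    ... | fits₁ , gs₁≡1+s₁ , _ | _ , gs₁≡p+s₂ , _ =
      <⇒≱ (<ᵇ⇒<′ fits₁) (subst (p ≤_) (trans (sym gs₁≡p+s₂) gs₁≡1+s₁) (m≤m+n p s₂))

    short₂-excludes-cross : T (placed short₂ s₁ s₂ g) → ¬ T (placed cross s₁ s₂ g)
    short₂-excludes-cross {s₁} {s₂} t₂ t₃ with placed⁻ {s₁ = s₁} short₂ t₂ | placed⁻ cross t₃
    ... | _ , gj≡1+j , _ | fits₃ , _ , gj≡s₁ =
      <⇒≱ (proj₁ (cross-fits fits₃)) (subst (p ≤_) (trans (sym gj≡1+j) gj≡s₁) (≤-trans (m≤m+n p s₂) (n≤1+n _)))

    viaPiece-absent : ∀ x c k → ¬ T (placed x s₁ s₂ g) → viaPiece x c k s₁ s₂ ≡ 0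
    viaPiece-absent {s₁} {s₂} x c k ¬t = cong (_* countMatches c k (step₁ x s₁) (step₂ x s₂)) (χ-false ¬t)

    viaShort₁-absent : ∀ b k → ¬ T (placed short₁ s₁ s₂ g) → viaShort₁ b k s₁ s₂ ≡ 0
    viaShort₁-absent false k   = viaPiece-absent short₁ false k
    viaShort₁-absent true  k _ = refl

    -- A short₂ leaves s₁ in place, so a short₁ at s₁ stays placeable but is forbidden forever after.
    short₁-blocks  : T (placed short₁ s₁ s₂ g) → ∀ k → countMatches true k s₁ s₂ ≡ 0
    short₂-blocked : T (placed short₁ s₁ s₂ g) → ∀ k → viaPiece short₂ true k s₁ s₂ ≡ 0

    short₁-blocks {s₁} {s₂} t₁ zero = cong (_+ 0) (χ-false (<⇒≢ s₁<p ∘ proj₁ ∘ Equivalence.to (T-done {s₂ = s₂})))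
      where s₁<p = <-trans (n<1+n s₁) (<ᵇ⇒<′ (proj₁ (placed⁻ {s₂ = s₂} short₁ t₁)))
    short₁-blocks t₁ (suc k) = trans (countMatches-suc true k)
      (cong₂ _+_ (short₂-blocked t₁ k) (viaPiece-absent cross false k (short₁-excludes-cross t₁)))

    short₂-blocked {s₁} {s₂} t₁ k =
      trans (cong (χ (placed short₂ s₁ s₂ g) *_) (short₁-blocks t₁ k)) (*-zeroʳ (χ (placed short₂ s₁ s₂ g)))

    short₂-placed : Admissible s₁ s₂ g → s₂ < q → p ≤ g (p + s₂) → T (placed short₂ s₁ s₂ g)
    short₂-placed {s₁} {s₂} A s₂<q p≤gj with pairs A (unscanned-first₂ s₂<q)
    ... | gu , ggj , _ with adjacent₂ A (unscanned-first₂ s₂<q) (m≤m+n p s₂) p≤gj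
    ...   | inj₁ gj≡1+j = placed⁺ {s₁ = s₁} short₂ (<⇒<ᵇ 1+s₂<q) gj≡1+j (trans (cong g (sym gj≡1+j)) ggj)
      where 1+s₂<q = +-cancelˡ-< p (suc s₂) q (subst (_< p + q) (trans gj≡1+j (sym (+-suc p s₂))) (unscanned-< gu))
    ...   | inj₂ j≡1+gj = ⊥-elim (<⇒≱ (subst (g (p + s₂) <_) (sym j≡1+gj) (n<1+n _)) (unscanned-line₂ gu p≤gj))

    short₁-placed : Admissible s₁ s₂ g → s₁ < p → g s₁ < p → T (placed short₁ s₁ s₂ g)
    short₁-placed {s₁} {s₂} A s₁<p gs₁<p
      with pairs A (unscanned-first₁ s₁<p) | adjacent₁ A (unscanned-first₁ s₁<p) s₁<p gs₁<p
    ... | _ , ggs₁ , _ | inj₁ gs₁≡1+s₁ =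
      placed⁺ {s₂ = s₂} short₁ (<⇒<ᵇ (subst (_< p) gs₁≡1+s₁ gs₁<p)) gs₁≡1+s₁ (trans (cong g (sym gs₁≡1+s₁)) ggs₁)
    ... | gu , _ , _ | inj₂ s₁≡1+gs₁ =
      ⊥-elim (<⇒≱ (subst (g s₁ <_) (sym s₁≡1+gs₁) (n<1+n _)) (unscanned-line₁ gu gs₁<p))

    cross-placed : Admissible s₁ s₂ g → s₁ < p → g s₁ ≡ p + s₂ → T (placed cross s₁ s₂ g)
    cross-placed {s₁} {s₂} A s₁<p gs₁≡j with pairs A (unscanned-first₁ s₁<p)
    ... | gu , ggs₁ , _ = placed⁺ cross (T-∧⁺ (<⇒<ᵇ s₁<p) (<⇒<ᵇ s₂<q)) gs₁≡j (trans (cong g (sym gs₁≡j)) ggs₁)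
      where s₂<q = +-cancelˡ-< p s₂ q (subst (_< p + q) gs₁≡j (unscanned-< gu))

    first-line-scanned : Admissible s₁ s₂ g → p ≤ s₁ → s₂ < q → p ≤ g (p + s₂)
    first-line-scanned {s₂ = s₂} A p≤s₁ s₂<q with g (p + s₂) <? p
    ... | no  gj≮p = ≮⇒≥ gj≮p
    ... | yes gj<p = ⊥-elim (<⇒≱ gj<p (≤-trans p≤s₁ (unscanned-line₁ (proj₁ (pairs A (unscanned-first₂ s₂<q))) gj<p)))

    -- Otherwise the partners of s₁ and p + s₂ would give two crossing segments between the lines.
    passed-over : Admissible s₁ s₂ g → s₁ < p → p + s₂ < g s₁ → s₂ < q × p ≤ g (p + s₂)
    passed-over {s₁} {s₂} A s₁<p j<gs₁ = s₂<q , p≤gj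
      where
      s₂<q = +-cancelˡ-< p s₂ q (<-trans j<gs₁ (unscanned-< (proj₁ (pairs A (unscanned-first₁ s₁<p)))))
      p≤gj : p ≤ g (p + s₂)
      p≤gj with g (p + s₂) <? p | pairs A (unscanned-first₂ {s₁ = s₁} s₂<q)
      ... | no  gj≮p | _ = ≮⇒≥ gj≮p
      ... | yes gj<p | gv , ggj , _ with m≤n⇒m<n∨m≡n (unscanned-line₁ gv gj<p)
      ...   | inj₂ s₁≡gj = ⊥-elim (<-irrefl (sym (trans (cong g s₁≡gj) ggj)) j<gs₁)
      ...   | inj₁ s₁<gj = ⊥-elim (<-asym j<gs₁ (subst (g s₁ <_) ggj
                (monotone A (unscanned-first₁ s₁<p) gv s₁<gj gj<p
                           (≤-trans (m≤m+n p s₂) (<⇒≤ j<gs₁)) (subst (p ≤_) (sym ggj) (m≤m+n p s₂)))))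

    placed-piece : Admissible s₁ s₂ g → s₁ < p ⊎ s₂ < q →
                   T (placed short₁ s₁ s₂ g) ⊎ T (placed short₂ s₁ s₂ g) ⊎ T (placed cross s₁ s₂ g)
    placed-piece {s₁} {s₂} A s₁<p⊎s₂<q with s₁ <? p
    ... | no s₁≮p = inj₂ (inj₁ (short₂-placed A s₂<q (first-line-scanned A (≮⇒≥ s₁≮p) s₂<q)))
      where s₂<q = fromInj₂ (⊥-elim ∘ s₁≮p) s₁<p⊎s₂<q
    ... | yes s₁<p with g s₁ <? p
    ...   | yes gs₁<p = inj₁ (short₁-placed A s₁<p gs₁<p)
    ...   | no  gs₁≮p with m≤n⇒m<n∨m≡n (unscanned-line₂ (proj₁ (pairs A (unscanned-first₁ s₁<p))) (≮⇒≥ gs₁≮p))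
    ...     | inj₂ j≡gs₁ = inj₂ (inj₂ (cross-placed A s₁<p (sym j≡gs₁)))
    ...     | inj₁ j<gs₁ = inj₂ (inj₁ (short₂-placed A (proj₁ (passed-over A s₁<p j<gs₁)) (proj₂ (passed-over A s₁<p j<gs₁))))

    -- At each step exactly one piece is placed, except that short₁ and short₂ may both
    -- be; then only words continuing with short₁ can match.
    exactly-one-match : ∀ k b → Admissible s₁ s₂ g → Remaining k s₁ s₂ →
                        (b ≡ true → ¬ T (placed short₁ s₁ s₂ g)) → countMatches b k s₁ s₂ ≡ 1
    exactly-one-match zero b A rem _ = cong (_+ 0) (χ-true (Equivalence.from T-done (remaining-zero rem)))
    exactly-one-match {s₁} {s₂} (suc k) b A rem short₁-forbidden =
      trans (countMatches-suc b k) (by-first-piece b short₁-forbidden (T? (placed short₁ s₁ s₂ g)))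
      where
      continue : ∀ x c → T (placed x s₁ s₂ g) → (c ≡ true → ¬ T (placed short₁ (step₁ x s₁) (step₂ x s₂) g)) →
                 viaPiece x c k s₁ s₂ ≡ 1
      continue x c t flag = cong₂ _*_ (χ-true t)
        (exactly-one-match k c (admissible-step x t A) (remaining-step x (proj₁ (placed⁻ x t)) rem) flag)

      by-first-piece : ∀ b → (b ≡ true → ¬ T (placed short₁ s₁ s₂ g)) → Dec (T (placed short₁ s₁ s₂ g)) →
                       viaShort₁ b k s₁ s₂ + (viaPiece short₂ true k s₁ s₂ + viaPiece cross false k s₁ s₂) ≡ 1
      by-first-piece true  forbidden (yes t₁) = ⊥-elim (forbidden refl t₁)
      by-first-piece false _         (yes t₁) =
        cong₂ _+_ (continue short₁ false t₁ λ ())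
                  (cong₂ _+_ (short₂-blocked t₁ k) (viaPiece-absent cross false k (short₁-excludes-cross t₁)))
      by-first-piece b _ (no ¬t₁) with placed-piece A (remaining-suc rem)
      ... | inj₁ t₁        = ⊥-elim (¬t₁ t₁)
      ... | inj₂ (inj₁ t₂) =
        cong₂ _+_ (viaShort₁-absent b k ¬t₁)
                  (cong₂ _+_ (continue short₂ true t₂ (λ _ → ¬t₁)) (viaPiece-absent cross false k (short₂-excludes-cross t₂)))
      ... | inj₂ (inj₂ t₃) =
        cong₂ _+_ (viaShort₁-absent b k ¬t₁)
                  (cong₂ _+_ (viaPiece-absent short₂ true k (λ t₂ → short₂-excludes-cross t₂ t₃)) (continue cross false t₃ λ ()))

  -- decode w is matched by w itself, hence admissible, hence maps points to points.
  decode-bounded : ∀ w → Completes 0 0 w → ∀ {i} → i < p + q → decode 0 0 w i < p + q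
  decode-bounded w c i<n = unscanned-< (proj₁ (Admissible.pairs A (unscanned-initial i<n)))
    where A = admissible-of-matches (decode 0 0 w) w (matches⇐ (decode 0 0 w) w c (λ _ → refl))

  count-pairings : ∀ w → ∑[ σ ← allVecs (p + q) (p + q) ] χ (matches 0 0 w (at σ)) ≡ χ (uses p q w)
  count-pairings w with T? (uses p q w)
  ... | yes t = trans (count-agreeing (p + q) (p + q) (λ σ → matches 0 0 w (at σ)) (decode 0 0 w) (decode-bounded w c) agrees⇔)
                      (sym (χ-true t))
    where
    c : Completes 0 0 w
    c = Equivalence.to T-done t
    agrees⇔ : ∀ σ → T (matches 0 0 w (at σ)) ⇔ (∀ {i} → i < p + q → at σ i ≡ decode 0 0 w i)
    agrees⇔ σ = mk⇔ (λ m {i} i<n → proj₂ (matches⇒ (at σ) w m) (unscanned-initial i<n))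
                    (λ agrees → matches⇐ (at σ) w c (agrees ∘ unscanned-<))
  ... | no ¬t = trans (∑-zero (allVecs (p + q) (p + q))
                             (λ σ → χ-false (¬t ∘ Equivalence.from T-done ∘ proj₁ ∘ matches⇒ (at σ) w)))
                      (sym (χ-false ¬t))

-- Admissible pairings are the non-crossing ones

module Segments (p q : ℕ) where
  open Geometry p
  open Scanning p q

  private variable
    x y u v i j w : ℕ
    g : ℕ → ℕ

  IsPairing : (ℕ → ℕ) → Set
  IsPairing g = ∀ {i} → i < p + q → g i < p + q × g (g i) ≡ i × g i ≢ i

  NonCrossing : (ℕ → ℕ) → Set
  NonCrossing g = ∀ {i j} → i < p + q → j < p + q → j ≢ i → j ≢ g i → ¬ T (meet i (g i) j (g j))

  SameLine OppositeLines : ℕ → ℕ → Set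
  SameLine      x y = (x < p × y < p) ⊎ (p ≤ x × p ≤ y)
  OppositeLines x y = (x < p × p ≤ y) ⊎ (p ≤ x × y < p)

  onFirst-< : x < p → onFirst x ≡ true
  onFirst-< = Equivalence.to T-≡ ∘ <⇒<ᵇ

  onFirst-≥ : p ≤ x → onFirst x ≡ false
  onFirst-≥ p≤x = ¬T⇒≡false (λ t → <⇒≱ (<ᵇ⇒< _ _ t) p≤x)

  sameLine-true : SameLine x y → sameLine x y ≡ true
  sameLine-true (inj₁ (x<p , y<p)) rewrite onFirst-< x<p | onFirst-< y<p = refl
  sameLine-true (inj₂ (p≤x , p≤y)) rewrite onFirst-≥ p≤x | onFirst-≥ p≤y = refl

  sameLine-false : OppositeLines x y → sameLine x y ≡ false
  sameLine-false (inj₁ (x<p , p≤y)) rewrite onFirst-< x<p | onFirst-≥ p≤y = refl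
  sameLine-false (inj₂ (p≤x , y<p)) rewrite onFirst-≥ p≤x | onFirst-< y<p = refl

  line-cases : ∀ x y → SameLine x y ⊎ OppositeLines x y
  line-cases x y with x <? p | y <? p
  ... | yes x<p | yes y<p = inj₁ (inj₁ (x<p , y<p))
  ... | yes x<p | no  y≮p = inj₂ (inj₁ (x<p , ≮⇒≥ y≮p))
  ... | no  x≮p | yes y<p = inj₂ (inj₂ (≮⇒≥ x≮p , y<p))
  ... | no  x≮p | no  y≮p = inj₁ (inj₂ (≮⇒≥ x≮p , ≮⇒≥ y≮p))

  meet-same-same : sameLine x y ≡ true → sameLine u v ≡ true →
                   meet x y u v ≡ (onFirst x == onFirst u) ∧ (((x ⊓ y) ⊔ (u ⊓ v)) ≤ᵇ ((x ⊔ y) ⊓ (u ⊔ v)))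
  meet-same-same e₁ e₂ rewrite e₁ | e₂ = refl

  meet-same-opposite : sameLine x y ≡ true → sameLine u v ≡ false → meet x y u v ≡ containsPt x y (endOnLineOf x u v)
  meet-same-opposite e₁ e₂ rewrite e₁ | e₂ = refl

  meet-opposite-same : sameLine x y ≡ false → sameLine u v ≡ true → meet x y u v ≡ containsPt u v (endOnLineOf u x y)
  meet-opposite-same e₁ e₂ rewrite e₁ | e₂ = refl

  sameOrderᵇ : ℕ → ℕ → ℕ → ℕ → Bool
  sameOrderᵇ a b c d = ((a <ᵇ b) ∧ (c <ᵇ d)) ∨ ((b <ᵇ a) ∧ (d <ᵇ c))

  meet-opposite-opposite : sameLine x y ≡ false → sameLine u v ≡ false →
    meet x y u v ≡ not (sameOrderᵇ (firstEnd x y) (firstEnd u v) (secondEnd x y) (secondEnd u v))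
  meet-opposite-opposite e₁ e₂ rewrite e₁ | e₂ = refl

  SameLine-sym : SameLine x y → SameLine y x
  SameLine-sym (inj₁ (x<p , y<p)) = inj₁ (y<p , x<p)
  SameLine-sym (inj₂ (p≤x , p≤y)) = inj₂ (p≤y , p≤x)

  between-meets : SameLine x y → x ⊓ y ≤ j → j ≤ x ⊔ y → T (meet x y j v)
  between-meets {x} {y} {j} {v} xy lo hi = by-line (sameLine j v) refl
    where
    xj : SameLine x j
    xj = [ (λ (x<p , y<p) → inj₁ (x<p , ≤-<-trans hi (⊔-lub x<p y<p)))
         , (λ (p≤x , p≤y) → inj₂ (p≤x , ≤-trans (⊓-glb p≤x p≤y) lo)) ]′ xy
    j≤ : j ≤ (x ⊔ y) ⊓ (j ⊔ v)
    j≤ = ⊓-glb hi (m≤m⊔n j v)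
    end≡j : endOnLineOf x j v ≡ j
    end≡j = cong (λ b → if b then j else v) (sameLine-true (SameLine-sym xj))
    by-line : ∀ b → sameLine j v ≡ b → T (meet x y j v)
    by-line true e = subst T (sym (meet-same-same (sameLine-true xy) e))
      (T-∧⁺ (subst T (sym (sameLine-true xj)) _) (≤⇒≤ᵇ′ (⊔-lub (≤-trans lo j≤) (≤-trans (m⊓n≤m j v) j≤))))
    by-line false e = subst T (sym (meet-same-opposite (sameLine-true xy) e))
      (subst (λ z → T (containsPt x y z)) (sym end≡j) (T-∧⁺ (≤⇒≤ᵇ′ lo) (≤⇒≤ᵇ′ hi)))

  crossing-meets : x < p → p ≤ y → u < p → p ≤ v → x < u → v < y → T (meet x y u v)
  crossing-meets {x} {y} {u} {v} x<p p≤y u<p p≤v x<u v<y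
    rewrite meet-opposite-opposite (sameLine-false (inj₁ (x<p , p≤y))) (sameLine-false (inj₁ (u<p , p≤v)))
          | onFirst-< x<p | onFirst-< u<p
    = T-not⁺ (λ t → [ (λ t₁ → <⇒≱ v<y (<⇒≤ (<ᵇ⇒< _ _ (proj₂ (T-∧⁻ t₁)))))
                    , (λ t₂ → <⇒≱ x<u (<⇒≤ (<ᵇ⇒< _ _ (proj₁ (T-∧⁻ t₂))))) ]′ (Equivalence.to T-∨ t))

  module _ {g : ℕ → ℕ} (A : Admissible 0 0 g) where
    open Admissible A

    pairing-of-admissible : IsPairing g
    pairing-of-admissible i<n with pairs (unscanned-initial i<n)
    ... | gu , ggi , gi≢i = unscanned-< gu , ggi , gi≢i

    private
      Ends : ℕ → ℕ → Set
      Ends i w = w ≡ i ⊎ w ≡ g i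

      involutive : ∀ {i} → i < p + q → g (g i) ≡ i
      involutive = proj₁ ∘ proj₂ ∘ pairing-of-admissible

      disjoint-ends : i < p + q → j < p + q → j ≢ i → j ≢ g i → Ends i w → Ends j w → ⊥
      disjoint-ends i<n j<n j≢i j≢gi (inj₁ refl) (inj₁ i≡j)  = j≢i (sym i≡j)
      disjoint-ends i<n j<n j≢i j≢gi (inj₁ refl) (inj₂ i≡gj) = j≢gi (trans (sym (involutive j<n)) (cong g (sym i≡gj)))
      disjoint-ends i<n j<n j≢i j≢gi (inj₂ refl) (inj₁ gi≡j) = j≢gi (sym gi≡j)
      disjoint-ends i<n j<n j≢i j≢gi (inj₂ refl) (inj₂ gi≡gj) =
        j≢i (trans (sym (involutive j<n)) (trans (cong g (sym gi≡gj)) (involutive i<n)))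

      in-segment : i < p + q → SameLine i (g i) → i ⊓ g i ≤ w → w ≤ i ⊔ g i → Ends i w
      in-segment i<n (inj₁ (i<p , gi<p)) = Adjacent-interval (adjacent₁ (unscanned-initial i<n) i<p gi<p)
      in-segment i<n (inj₂ (p≤i , p≤gi)) = Adjacent-interval (adjacent₂ (unscanned-initial i<n) p≤i p≤gi)

      other-end : ∀ i j → Ends j (endOnLineOf i j (g j))
      other-end i j = if-either (onFirst j == onFirst i) j (g j)

      record CrossEnd (i : ℕ) : Set where
        field
          end     : ℕ
          first≡  : firstEnd i (g i) ≡ end
          second≡ : secondEnd i (g i) ≡ g end
          end<p   : end < p
          p≤g-end : p ≤ g end
          is-end  : Ends i end
          end<n   : end < p + q

      cross-end : i < p + q → OppositeLines i (g i) → CrossEnd i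
      cross-end {i} i<n (inj₁ (i<p , p≤gi)) = record
        { end = i ; first≡ = cong (λ b → if b then i else g i) (onFirst-< i<p)
        ; second≡ = cong (λ b → if b then g i else i) (onFirst-< i<p)
        ; end<p = i<p ; p≤g-end = p≤gi ; is-end = inj₁ refl ; end<n = i<n }
      cross-end {i} i<n (inj₂ (p≤i , gi<p)) = record
        { end = g i ; first≡ = cong (λ b → if b then i else g i) (onFirst-≥ p≤i)
        ; second≡ = trans (cong (λ b → if b then g i else i) (onFirst-≥ p≤i)) (sym (involutive i<n))
        ; end<p = gi<p ; p≤g-end = subst (p ≤_) (sym (involutive i<n)) p≤i
        ; is-end = inj₂ refl ; end<n = proj₁ (pairing-of-admissible i<n) }

    noncrossing-of-admissible : NonCrossing g
    noncrossing-of-admissible {i} {j} i<n j<n j≢i j≢gi t with line-cases i (g i) | line-cases j (g j)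
    ... | inj₁ si | inj₁ sj =
      disjoint-ends i<n j<n j≢i j≢gi (in-segment i<n si (m≤m⊔n _ _) (≤-trans common (m⊓n≤m _ _)))
                                     (in-segment j<n sj (m≤n⊔m _ _) (≤-trans common (m⊓n≤n _ _)))
      where
      common : (i ⊓ g i) ⊔ (j ⊓ g j) ≤ (i ⊔ g i) ⊓ (j ⊔ g j)
      common = ≤ᵇ⇒≤′ (proj₂ (T-∧⁻ (subst T (meet-same-same (sameLine-true si) (sameLine-true sj)) t)))
    ... | inj₁ si | inj₂ oj with T-∧⁻ (subst T (meet-same-opposite (sameLine-true si) (sameLine-false oj)) t)
    ...   | lo , hi = disjoint-ends i<n j<n j≢i j≢gi (in-segment i<n si (≤ᵇ⇒≤′ lo) (≤ᵇ⇒≤′ hi)) (other-end i j)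
    noncrossing-of-admissible {i} {j} i<n j<n j≢i j≢gi t | inj₂ oi | inj₁ sj
      with T-∧⁻ (subst T (meet-opposite-same (sameLine-false oi) (sameLine-true sj)) t)
    ... | lo , hi = disjoint-ends i<n j<n j≢i j≢gi (other-end j i) (in-segment j<n sj (≤ᵇ⇒≤′ lo) (≤ᵇ⇒≤′ hi))
    noncrossing-of-admissible {i} {j} i<n j<n j≢i j≢gi t | inj₂ oi | inj₂ oj =
      T-not⁻ (subst T (meet-opposite-opposite (sameLine-false oi) (sameLine-false oj)) t)
        (subst₂ (λ a b → T (sameOrderᵇ a b (secondEnd i (g i)) (secondEnd j (g j)))) (sym (first≡ ci)) (sym (first≡ cj))
          (subst₂ (λ c d → T (sameOrderᵇ e₁ e₂ c d)) (sym (second≡ ci)) (sym (second≡ cj)) ordered))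
      where
      open CrossEnd
      ci = cross-end i<n oi
      cj = cross-end j<n oj
      e₁ = end ci
      e₂ = end cj
      ordered : T (sameOrderᵇ e₁ e₂ (g e₁) (g e₂))
      ordered with <-cmp e₁ e₂
      ... | tri< e₁<e₂ _ _ = Equivalence.from T-∨ (inj₁ (T-∧⁺ (<⇒<ᵇ e₁<e₂)
              (<⇒<ᵇ (monotone (unscanned-initial (end<n ci)) (unscanned-initial (end<n cj))
                               e₁<e₂ (end<p cj) (p≤g-end ci) (p≤g-end cj)))))
      ... | tri≈ _ e₁≡e₂ _ = ⊥-elim (disjoint-ends i<n j<n j≢i j≢gi (is-end ci) (subst (Ends j) (sym e₁≡e₂) (is-end cj)))
      ... | tri> _ _ e₂<e₁ = Equivalence.from T-∨ (inj₂ (T-∧⁺ (<⇒<ᵇ e₂<e₁)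
              (<⇒<ᵇ (monotone (unscanned-initial (end<n cj)) (unscanned-initial (end<n ci))
                               e₂<e₁ (end<p ci) (p≤g-end cj) (p≤g-end ci)))))

  module _ {g : ℕ → ℕ} (P : IsPairing g) (N : NonCrossing g) where

    between-blocked : i < p + q → SameLine i (g i) → i ⊓ g i ≤ j → j ≤ i ⊔ g i → j ≢ i → j ≢ g i → ⊥
    between-blocked i<n same lo hi j≢i j≢gi =
      N i<n (≤-<-trans hi (⊔-lub i<n (proj₁ (P i<n)))) j≢i j≢gi (between-meets same lo hi)

    same-line-adjacent : i < p + q → SameLine i (g i) → Adjacent i (g i)
    same-line-adjacent {i} i<n same with <-cmp i (g i)
    ... | tri≈ _ i≡gi _ = ⊥-elim (proj₂ (proj₂ (P i<n)) (sym i≡gi))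
    ... | tri< i<gi _ _ = inj₁ (no-gap i<gi λ i<j j<gi → between-blocked i<n same
            (≤-trans (m⊓n≤m i (g i)) (<⇒≤ i<j)) (≤-trans (<⇒≤ j<gi) (m≤n⊔m i (g i))) (>⇒≢ i<j) (<⇒≢ j<gi))
    ... | tri> _ _ gi<i = inj₂ (no-gap gi<i λ gi<j j<i → between-blocked i<n same
            (≤-trans (m⊓n≤n i (g i)) (<⇒≤ gi<j)) (≤-trans (<⇒≤ j<i) (m≤m⊔n i (g i))) (<⇒≢ j<i) (>⇒≢ gi<j))

    admissible-of-noncrossing : Admissible 0 0 g
    admissible-of-noncrossing = record
      { pairs     = λ u → unscanned-initial (proj₁ (P (unscanned-< u))) , proj₂ (P (unscanned-< u))
      ; adjacent₁ = λ u i<p gi<p → same-line-adjacent (unscanned-< u) (inj₁ (i<p , gi<p))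
      ; adjacent₂ = λ u p≤i p≤gi → same-line-adjacent (unscanned-< u) (inj₂ (p≤i , p≤gi))
      ; monotone  = monotone′
      }
      where
      monotone′ : Unscanned 0 0 i → Unscanned 0 0 j → i < j → j < p → p ≤ g i → p ≤ g j → g i < g j
      monotone′ {i} {j} u v i<j j<p p≤gi p≤gj with <-cmp (g i) (g j)
      ... | tri< gi<gj _ _ = gi<gj
      ... | tri≈ _ gi≡gj _ = ⊥-elim (<-irrefl (trans (sym (proj₁ (proj₂ (P (unscanned-< u)))))
                                           (trans (cong g gi≡gj) (proj₁ (proj₂ (P (unscanned-< v)))))) i<j)
      ... | tri> _ _ gj<gi = ⊥-elim (N (unscanned-< u) (unscanned-< v) (>⇒≢ i<j) (<⇒≢ (<-≤-trans j<p p≤gi))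
                                      (crossing-meets (<-trans i<j j<p) p≤gi j<p p≤gj i<j gj<gi))

  open Matchings p q using (allB; isPairing; nonCrossing; valid)

  T-allB-allFin : ∀ {n} (f : Fin n → Bool) → T (allB f (allFin n)) ⇔ (∀ i → T (f i))
  T-allB-allFin f = mk⇔ (tabulate⁻ ∘ to (allFin _)) (from (allFin _) ∘ tabulate⁺)
    where
    to : ∀ xs → T (allB f xs) → All (T ∘ f) xs
    to []       _ = []
    to (x ∷ xs) t = proj₁ (T-∧⁻ t) ∷ to xs (proj₂ (T-∧⁻ t))
    from : ∀ xs → All (T ∘ f) xs → T (allB f xs)
    from []       []         = _
    from (x ∷ xs) (fx ∷ fxs) = T-∧⁺ fx (from xs fxs)

  pairingᵇ : (ℕ → ℕ) → ℕ → Bool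
  pairingᵇ g i = (g (g i) ≡ᵇ i) ∧ not (g i ≡ᵇ i)

  T-pairingᵇ : ∀ g i → T (pairingᵇ g i) ⇔ (g (g i) ≡ i × g i ≢ i)
  T-pairingᵇ g i = mk⇔ (λ t → ≡ᵇ⇒≡ _ _ (proj₁ (T-∧⁻ t)) , T-not⁻ (proj₂ (T-∧⁻ t)) ∘ ≡⇒≡ᵇ _ _)
                   (λ (ggi , gi≢i) → T-∧⁺ (≡⇒≡ᵇ _ _ ggi) (T-not⁺ (gi≢i ∘ ≡ᵇ⇒≡ _ _)))

  disjointᵇ : (ℕ → ℕ) → ℕ → ℕ → Bool
  disjointᵇ g i j = (j ≡ᵇ i) ∨ (j ≡ᵇ g i) ∨ not (meet i (g i) j (g j))

  T-disjointᵇ : ∀ g i j → T (disjointᵇ g i j) ⇔ (j ≢ i → j ≢ g i → ¬ T (meet i (g i) j (g j)))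
  T-disjointᵇ g i j = mk⇔ to from
    where
    to : T (disjointᵇ g i j) → j ≢ i → j ≢ g i → ¬ T (meet i (g i) j (g j))
    to t j≢i j≢gi m with Equivalence.to (T-∨ {j ≡ᵇ i}) t
    ... | inj₁ t₁ = j≢i (≡ᵇ⇒≡ _ _ t₁)
    ... | inj₂ t₂ with Equivalence.to (T-∨ {j ≡ᵇ g i}) t₂
    ...   | inj₁ t₃ = j≢gi (≡ᵇ⇒≡ _ _ t₃)
    ...   | inj₂ t₄ = T-not⁻ t₄ m
    from : (j ≢ i → j ≢ g i → ¬ T (meet i (g i) j (g j))) → T (disjointᵇ g i j)
    from h with T? (j ≡ᵇ i) | T? (j ≡ᵇ g i)
    ... | yes t₁ | _      = Equivalence.from (T-∨ {j ≡ᵇ i}) (inj₁ t₁)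
    ... | no ¬t₁ | yes t₂ = Equivalence.from (T-∨ {j ≡ᵇ i}) (inj₂ (Equivalence.from (T-∨ {j ≡ᵇ g i}) (inj₁ t₂)))
    ... | no ¬t₁ | no ¬t₂ = Equivalence.from (T-∨ {j ≡ᵇ i}) (inj₂ (Equivalence.from (T-∨ {j ≡ᵇ g i}) (inj₂
                              (T-not⁺ (h (¬t₁ ∘ ≡⇒≡ᵇ _ _) (¬t₂ ∘ ≡⇒≡ᵇ _ _))))))

  module _ (σ : Vec (Fin (p + q)) (p + q)) where

    private
      lookup-at : ∀ i → toℕ (lookup σ i) ≡ at σ (toℕ i)
      lookup-at i = sym (at-lookup σ i)

      pairing-entry : ∀ i → ((toℕ (lookup σ (lookup σ i)) ≡ᵇ toℕ i) ∧ not (toℕ (lookup σ i) ≡ᵇ toℕ i))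
                            ≡ pairingᵇ (at σ) (toℕ i)
      pairing-entry i = cong₂ (λ a b → (a ≡ᵇ toℕ i) ∧ not (b ≡ᵇ toℕ i))
                              (trans (lookup-at (lookup σ i)) (cong (at σ) (lookup-at i))) (lookup-at i)

      disjoint-entry : ∀ i j → ((toℕ j ≡ᵇ toℕ i) ∨ (toℕ j ≡ᵇ toℕ (lookup σ i))
                                ∨ not (meet (toℕ i) (toℕ (lookup σ i)) (toℕ j) (toℕ (lookup σ j))))
                               ≡ disjointᵇ (at σ) (toℕ i) (toℕ j)
      disjoint-entry i j =
        cong₂ (λ a b → (toℕ j ≡ᵇ toℕ i) ∨ (toℕ j ≡ᵇ a) ∨ not (meet (toℕ i) a (toℕ j) b)) (lookup-at i) (lookup-at j)

      isPairing⇔ : T (isPairing σ) ⇔ IsPairing (at σ)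
      isPairing⇔ = mk⇔
        (λ t {i} i<n → at-< σ i<n , Equivalence.to (T-pairingᵇ (at σ) i)
           (Equivalence.to ∀Fin⇔∀< (λ k → subst T (pairing-entry k) (Equivalence.to (T-allB-allFin _) t k)) i<n))
        (λ P → Equivalence.from (T-allB-allFin _) λ k →
           subst T (sym (pairing-entry k)) (Equivalence.from (T-pairingᵇ (at σ) (toℕ k)) (proj₂ (P (toℕ<n k)))))

      nonCrossing⇔ : T (nonCrossing σ) ⇔ NonCrossing (at σ)
      nonCrossing⇔ = mk⇔
        (λ t {i} {j} i<n j<n → Equivalence.to (T-disjointᵇ (at σ) i j)
           (Equivalence.to ∀Fin⇔∀< (λ l → Equivalence.to ∀Fin⇔∀< (λ k →
              subst T (disjoint-entry k l) (Equivalence.to (T-allB-allFin _) (Equivalence.to (T-allB-allFin _) t k) l)) i<n) j<n))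
        (λ N → Equivalence.from (T-allB-allFin _) λ k → Equivalence.from (T-allB-allFin _) λ l →
           subst T (sym (disjoint-entry k l)) (Equivalence.from (T-disjointᵇ (at σ) (toℕ k) (toℕ l)) (N (toℕ<n k) (toℕ<n l))))

    valid⇔admissible : T (valid σ) ⇔ Admissible 0 0 (at σ)
    valid⇔admissible = mk⇔
      (λ t → admissible-of-noncrossing (Equivalence.to isPairing⇔ (proj₁ (T-∧⁻ t))) (Equivalence.to nonCrossing⇔ (proj₂ (T-∧⁻ t))))
      (λ A → T-∧⁺ (Equivalence.from isPairing⇔ (pairing-of-admissible A)) (Equivalence.from nonCrossing⇔ (noncrossing-of-admissible A)))

-- Counting

a-as-words : ∀ p q m → p + q ≡ 2 * m → a p q ≡ ∑[ w ← canonical false m ] χ (uses p q w)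
a-as-words p q m p+q≡2m = begin
  a p q
    ≡⟨ length-filterᵇ valid (allVecs (p + q) (p + q)) ⟩
  ∑[ σ ← allVecs (p + q) (p + q) ] χ (valid σ)
    ≡⟨ ∑-cong (allVecs (p + q) (p + q)) valid-as-matches ⟩
  ∑[ σ ← allVecs (p + q) (p + q) ] ∑[ w ← canonical false m ] χ (matches 0 0 w (at σ))
    ≡⟨ ∑-swap (allVecs (p + q) (p + q)) (canonical false m) (λ σ w → χ (matches 0 0 w (at σ))) ⟩
  ∑[ w ← canonical false m ] ∑[ σ ← allVecs (p + q) (p + q) ] χ (matches 0 0 w (at σ))
    ≡⟨ ∑-cong (canonical false m) count-pairings ⟩
  ∑[ w ← canonical false m ] χ (uses p q w) ∎
  where
  open ≡-Reasoning
  open Matchings p q using (valid)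
  open Scanning p q
  open Segments p q using (valid⇔admissible)
  valid-as-matches : ∀ σ → χ (valid σ) ≡ countMatches (at σ) false m 0 0
  valid-as-matches σ with T? (valid σ)
  ... | yes t = trans (χ-true t) (sym (exactly-one-match (at σ) m false (Equivalence.to (valid⇔admissible σ) t)
                                                         (z≤n , z≤n , sym p+q≡2m) (λ ())))
  ... | no ¬t = trans (χ-false ¬t) (sym (∑-zero (canonical false m)
                  (λ w → χ-false (¬t ∘ Equivalence.from (valid⇔admissible σ) ∘ admissible-of-matches (at σ) w))))

uses-diagonal : ∀ N w → count₁ w + count₂ w ≡ N → ∑[ k ← upTo (suc N) ] χ (uses k (N ∸ k) w) ≡ 1
uses-diagonal N w c₁+c₂≡N = trans (∑-cong (upTo (suc N)) only-count₁) (count-upTo (suc N) (count₁ w) c₁<1+N)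
  where
  c₁<1+N = s≤s (subst (count₁ w ≤_) c₁+c₂≡N (m≤m+n _ _))
  only-count₁ : ∀ k → χ (uses k (N ∸ k) w) ≡ χ (count₁ w ≡ᵇ k)
  only-count₁ k with count₁ w ≟ k
  ... | yes refl = trans (χ-true (T-∧⁺ (≡⇒≡ᵇ k k refl) (≡⇒≡ᵇ _ _ c₂≡N∸c₁))) (sym (χ-true (≡⇒≡ᵇ k k refl)))
    where c₂≡N∸c₁ = sym (trans (cong (_∸ count₁ w) (sym c₁+c₂≡N)) (m+n∸m≡n (count₁ w) (count₂ w)))
  ... | no c₁≢k = trans (χ-false (c₁≢k ∘ ≡ᵇ⇒≡ _ _ ∘ proj₁ ∘ T-∧⁻)) (sym (χ-false (c₁≢k ∘ ≡ᵇ⇒≡ _ _)))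

mainTheorem16 : (m : ℕ) → diagSum (2 * m) ≡ F (2 * m + 2)
mainTheorem16 m = begin
  diagSum (2 * m)
    ≡⟨ ∑-cong-local (All.map (λ k<1+2m → a-as-words _ _ m (m+[n∸m]≡n (≤-pred k<1+2m))) (all-upTo (suc (2 * m)))) ⟩
  ∑[ k ← upTo (suc (2 * m)) ] ∑[ w ← canonical false m ] χ (uses k (2 * m ∸ k) w)
    ≡⟨ ∑-swap (upTo (suc (2 * m))) (canonical false m) (λ k w → χ (uses k (2 * m ∸ k) w)) ⟩
  ∑[ w ← canonical false m ] ∑[ k ← upTo (suc (2 * m)) ] χ (uses k (2 * m ∸ k) w)
    ≡⟨ ∑-ones (All.map (λ {w} ℓ≡m → uses-diagonal (2 * m) w (trans (count₁+count₂ w) (cong (2 *_) ℓ≡m)))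
                       (canonical-length false m)) ⟩
  length (canonical false m)
    ≡⟨ proj₁ (length-canonical m) ⟩
  F (2 + 2 * m)
    ≡⟨ cong F (+-comm 2 (2 * m)) ⟩
  F (2 * m + 2) ∎
  where open ≡-Reasoning
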